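{- Let $k\ge1$ and consider the Markov chain (the Harmonic Chain) on states $\{0,1,\dots,k\}$ in which state $0$ is absorbing and from each state $\ell\in\{1,\dots,k\}$ the chain moves to $\ell-1$ with probability $\frac1k$, to $\ell+1$ with probability $\frac{k-\ell}{k}$, and stays at $\ell$ with the remaining probability $1-\frac1k-\frac{k-\ell}{k}$. Let $h(\ell)=\mathbb{E}[N\mid X_0=\ell]$, where $N=\min\{\tau\ge0: X_\tau=0\}$. Then for every $\ell\in\{0,1,\dots,k\}$, $$h(\ell)=k\sum_{i=k-\ell+1}^{k}\alpha_i,$$ where $\alpha_1=1$ and $\alpha_i=1+(i-1)\alpha_{i-1}$ for $i>1$ (the sum is empty, hence $0$, for $\ell=0$).
   Context: $(X_\tau)_{\tau\ge0}$ denotes the Markov chain described in the claim; $h(\ell)$ is its expected absorption (extinction) time from state $\ell$. -}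

module Defs where

open import Data.Nat using (ℕ; zero; suc; _∸_)
import Data.Nat as ℕ
open import Data.Integer using (+_)
open import Data.Rational using (ℚ; 0ℚ; 1ℚ; _/_; _+_; _*_; _-_; ∣_∣; _<_)
open import Data.Product using (∃-syntax; _×_)
open import Relation.Nullary using (yes; no)
open import Relation.Nullary.Decidable using (⌊_⌋)
open import Data.Bool using (Bool; true; false; if_then_else_; _∧_)

-- n / k as a rational (k ≥ 1 in all uses; value 0 if k = 0)
frac : ℕ → ℕ → ℚ
frac n zero    = 0ℚ
frac n (suc m) = + n / suc m

sum1to : ℕ → (ℕ → ℚ) → ℚ
sum1to zero    f = 0ℚ
sum1to (suc k) f = sum1to k f + f (suc k)

sumBelow : ℕ → (ℕ → ℚ) → ℚ
sumBelow zero    f = 0ℚ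
sumBelow (suc T) f = sumBelow T f + f T

-- Σ_{i=a}^{b} f i over ℕ (empty, hence 0, when a > b)
sumFromTo : ℕ → ℕ → (ℕ → ℕ) → ℕ
sumFromTo a zero    f = if ⌊ a ℕ.≤? 0 ⌋ then f 0 else 0
sumFromTo a (suc b) f =
  sumFromTo a b f ℕ.+ (if ⌊ a ℕ.≤? suc b ⌋ then f (suc b) else 0)

-- α_1 = 1, α_i = 1 + (i-1) α_{i-1} for i > 1  (α_0 := 0 is never used)
α : ℕ → ℕ
α zero    = 0
α (suc i) = 1 ℕ.+ i ℕ.* α i

_==_ : ℕ → ℕ → Bool
m == n = ⌊ m ℕ.≟ n ⌋

P : ℕ → ℕ → ℕ → ℚ
P k zero j = if j == 0 then 1ℚ else 0ℚ
P k (suc i') j =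
  if suc j == i then frac 1 k
  else if j == suc i then frac (k ∸ i) k
  else if j == i then 1ℚ - frac 1 k - frac (k ∸ i) k
  else 0ℚ
  where i = suc i'

inRange : ℕ → ℕ → Bool
inRange k j = ⌊ 1 ℕ.≤? j ⌋ ∧ ⌊ j ℕ.≤? k ⌋

-- ν k ℓ t j = P_ℓ(X_t = j and X_s ≠ 0 for all s ≤ t)   (for j ≠ 0)
ν : ℕ → ℕ → ℕ → ℕ → ℚ
ν k ℓ zero    j = if inRange k j ∧ (j == ℓ) then 1ℚ else 0ℚ
ν k ℓ (suc t) j =
  if inRange k j then sum1to k (λ i → ν k ℓ t i * P k i j) else 0ℚ

-- hit k ℓ t = P_ℓ(N = t), N = min{τ ≥ 0 : X_τ = 0}
hit : ℕ → ℕ → ℕ → ℚ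
hit k ℓ zero    = if ℓ == 0 then 1ℚ else 0ℚ
hit k ℓ (suc t) = sum1to k (λ i → ν k ℓ t i * P k i 0)

SeriesConvergesTo : (ℕ → ℚ) → ℚ → Set
SeriesConvergesTo f v =
  ∀ (ε : ℚ) → 0ℚ < ε → ∃[ T₀ ] ∀ T → T₀ ℕ.≤ T → ∣ sumBelow T f - v ∣ < ε

-- "h(ℓ) = E[N | X₀ = ℓ] equals v": N < ∞ almost surely and Σ_t t·P(N = t) = v
ExpectedAbsorptionTimeIs : ℕ → ℕ → ℚ → Set
ExpectedAbsorptionTimeIs k ℓ v =
  SeriesConvergesTo (hit k ℓ) 1ℚ ×
  SeriesConvergesTo (λ t → + t / 1 * hit k ℓ t) v

-- Let h be the solution of the first-step equations h 0 = 0, (P h)(i) = h(i) − 1 on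
-- {1,…,k}: its increments are h(j+1) − h(j) = k α_{k−j}. For the law ν_t of the chain
-- killed at 0 put S_t = Σ_j ν_t(j) = P(N > t) and M_t = Σ_j ν_t(j) h(j). The first-step
-- equations give S_t − S_{t+1} = P(N = t+1) and M_t − M_{t+1} = S_t, so the partial sums
-- of P(N = t) and of t·P(N = t) up to T are 1 − S_T and h(ℓ) − M_T − T·S_T. As
-- 1 ≤ h ≤ H on {1,…,k}, S_t ≤ M_t ≤ H·S_t and hence M_{t+1} ≤ (1 − 1/H)·M_t; this
-- geometric decay makes (T+1)·M_T, which bounds both errors, tend to 0.
{-# OPTIONS --safe #-}
module Submission where

open import Defs
open import Data.Nat using (ℕ; _≤_; _∸_; _+_; _*_)
open import Data.Integer using (+_)
open import Data.Rational using (_/_)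

open import Data.Nat using (zero; suc; z≤n; s≤s; _<_; _≟_; _≤?_)
import Data.Nat.Properties as ℕ
import Data.Nat.Tactic.RingSolver as ℕ-Solver
import Data.Integer as ℤ
import Data.Integer.Properties as ℤ
open import Data.Rational as ℚ using (ℚ; 0ℚ; 1ℚ; mkℚ)
  renaming (_+_ to _⊕_; _*_ to _⊗_; _-_ to _⊖_; -_ to ⊝_; _≤_ to _≤ℚ_; _<_ to _<ℚ_)
import Data.Rational.Properties as ℚ
import Data.Rational.Unnormalised as ℚᵘ
import Data.Rational.Unnormalised.Properties as ℚᵘ
open import Data.Rational.Solver using (module +-*-Solver)
open +-*-Solver using (solve; _:+_; _:*_; _:-_; :-_; _:=_; con)
open import Data.Bool using (Bool; true; false; if_then_else_; _∧_)
open import Data.Empty using (⊥-elim)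
open import Data.Product using (_,_; ∃-syntax; proj₁; proj₂)
open import Data.Sum using (inj₁; inj₂)
open import Function using (_∘_)
open import Relation.Binary.PropositionalEquality
open import Relation.Nullary using (Dec; yes; no; ¬_)
open import Relation.Nullary.Decidable using (⌊_⌋; dec-true; dec-false; isYes≗does)

fromℕ : ℕ → ℚ
fromℕ n = + n / 1

≡-fromℚᵘ : ∀ {p : ℚ} u → ℚ.toℚᵘ p ℚᵘ.≃ u → p ≡ ℚ.fromℚᵘ u
≡-fromℚᵘ {p} u p≃u = trans (sym (ℚ.fromℚᵘ-toℚᵘ p)) (ℚ.fromℚᵘ-cong p≃u)

toℚᵘ-/ : ∀ n m → ℚ.toℚᵘ (+ n / suc m) ℚᵘ.≃ ℚᵘ.mkℚᵘ (+ n) m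
toℚᵘ-/ n m = ℚ.toℚᵘ-fromℚᵘ (ℚᵘ.mkℚᵘ (+ n) m)

fromℕ-+ : ∀ a b → fromℕ (a + b) ≡ fromℕ a ⊕ fromℕ b
fromℕ-+ a b = sym (≡-fromℚᵘ (ℚᵘ.mkℚᵘ (+ (a + b)) 0) (ℚᵘ.≃-trans (ℚ.toℚᵘ-homo-+ (fromℕ a) (fromℕ b))
  (ℚᵘ.≃-trans (ℚᵘ.+-cong (toℚᵘ-/ a 0) (toℚᵘ-/ b 0)) (ℚᵘ.*≡* cross))))
  where
  cross : (+ a ℤ.* + 1 ℤ.+ + b ℤ.* + 1) ℤ.* + 1 ≡ + (a + b) ℤ.* + 1
  cross = cong (ℤ._* + 1) (trans (cong₂ ℤ._+_ (ℤ.*-identityʳ (+ a)) (ℤ.*-identityʳ (+ b)))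
                                 (sym (ℤ.pos-+ a b)))

fromℕ-* : ∀ a b → fromℕ (a * b) ≡ fromℕ a ⊗ fromℕ b
fromℕ-* a b = sym (≡-fromℚᵘ (ℚᵘ.mkℚᵘ (+ (a * b)) 0) (ℚᵘ.≃-trans (ℚ.toℚᵘ-homo-* (fromℕ a) (fromℕ b))
  (ℚᵘ.≃-trans (ℚᵘ.*-cong (toℚᵘ-/ a 0) (toℚᵘ-/ b 0)) (ℚᵘ.*≡* (cong (ℤ._* + 1) (sym (ℤ.pos-* a b)))))))

frac≡fromℕ*frac1 : ∀ n m → frac n (suc m) ≡ fromℕ n ⊗ frac 1 (suc m)
frac≡fromℕ*frac1 n m = sym (≡-fromℚᵘ (ℚᵘ.mkℚᵘ (+ n) m) (ℚᵘ.≃-trans (ℚ.toℚᵘ-homo-* (fromℕ n) (frac 1 (suc m)))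
  (ℚᵘ.≃-trans (ℚᵘ.*-cong (toℚᵘ-/ n 0) (toℚᵘ-/ 1 m)) (ℚᵘ.*≡* cross))))
  where
  cross : (+ n ℤ.* + 1) ℤ.* + suc m ≡ + n ℤ.* + suc (m + 0)
  cross rewrite ℕ.+-identityʳ m = cong (ℤ._* + suc m) (ℤ.*-identityʳ (+ n))

fromℕ*frac1≡1 : ∀ m → fromℕ (suc m) ⊗ frac 1 (suc m) ≡ 1ℚ
fromℕ*frac1≡1 m = ≡-fromℚᵘ (ℚᵘ.mkℚᵘ (+ 1) 0) (ℚᵘ.≃-trans (ℚ.toℚᵘ-homo-* (fromℕ (suc m)) (frac 1 (suc m)))
  (ℚᵘ.≃-trans (ℚᵘ.*-cong (toℚᵘ-/ (suc m) 0) (toℚᵘ-/ 1 m)) (ℚᵘ.*≡* (cong (λ x → + suc x) cross))))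
  where
  cross : m * 1 * 1 ≡ m + 0 + 0
  cross = trans (ℕ.*-identityʳ (m * 1)) (trans (ℕ.*-identityʳ m) (sym (trans (ℕ.+-identityʳ (m + 0)) (ℕ.+-identityʳ m))))

0≤fromℕ : ∀ n → 0ℚ ≤ℚ fromℕ n
0≤fromℕ n = ℚ.nonNegative⁻¹ (fromℕ n) {{ℚ.normalize-nonNeg n 1}}

0≤frac : ∀ n m → 0ℚ ≤ℚ frac n (suc m)
0≤frac n m = ℚ.nonNegative⁻¹ (frac n (suc m)) {{ℚ.normalize-nonNeg n (suc m)}}

p≤p+q : ∀ {p} q → 0ℚ ≤ℚ q → p ≤ℚ p ⊕ q
p≤p+q {p} q 0≤q = begin
  p       ≡⟨ ℚ.+-identityʳ p ⟨
  p ⊕ 0ℚ  ≤⟨ ℚ.+-monoʳ-≤ p 0≤q ⟩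
  p ⊕ q   ∎
  where open ℚ.≤-Reasoning

fromℕ-mono-≤ : ∀ {a b} → a ≤ b → fromℕ a ≤ℚ fromℕ b
fromℕ-mono-≤ {a} {b} a≤b = begin
  fromℕ a                      ≤⟨ p≤p+q (fromℕ (b ∸ a)) (0≤fromℕ (b ∸ a)) ⟩
  fromℕ a ⊕ fromℕ (b ∸ a)      ≡⟨ fromℕ-+ a (b ∸ a) ⟨
  fromℕ (a + (b ∸ a))          ≡⟨ cong fromℕ (ℕ.m+[n∸m]≡n a≤b) ⟩
  fromℕ b                      ∎
  where open ℚ.≤-Reasoning

*-monoʳ-≤-0≤ : ∀ {p q} r → 0ℚ ≤ℚ r → p ≤ℚ q → p ⊗ r ≤ℚ q ⊗ r
*-monoʳ-≤-0≤ r 0≤r = ℚ.*-monoʳ-≤-nonNeg r {{ℚ.nonNegative 0≤r}}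

*-monoˡ-≤-0≤ : ∀ {p q} r → 0ℚ ≤ℚ r → p ≤ℚ q → r ⊗ p ≤ℚ r ⊗ q
*-monoˡ-≤-0≤ r 0≤r = ℚ.*-monoˡ-≤-nonNeg r {{ℚ.nonNegative 0≤r}}

0≤+ : ∀ {p q} → 0ℚ ≤ℚ p → 0ℚ ≤ℚ q → 0ℚ ≤ℚ p ⊕ q
0≤+ = ℚ.+-mono-≤

0≤* : ∀ {p q} → 0ℚ ≤ℚ p → 0ℚ ≤ℚ q → 0ℚ ≤ℚ p ⊗ q
0≤* {p} {q} 0≤p 0≤q = subst (_≤ℚ p ⊗ q) (ℚ.*-zeroˡ q) (*-monoʳ-≤-0≤ q 0≤q 0≤p)

archimedean₁ : ∀ ε → 0ℚ <ℚ ε → ∃[ d ] 1ℚ ≤ℚ fromℕ (suc d) ⊗ ε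
archimedean₁ ε@(mkℚ (+ suc n) d _) _ = d , ℚ.toℚᵘ-cancel-≤ (ℚᵘ.≤-respʳ-≃ (ℚᵘ.≃-sym dε≃) 1≤dε)
  where
  dε : ℚᵘ.ℚᵘ
  dε = ℚᵘ.mkℚᵘ (+ suc d) 0 ℚᵘ.* ℚᵘ.mkℚᵘ (+ suc n) d
  dε≃ : ℚ.toℚᵘ (fromℕ (suc d) ⊗ ε) ℚᵘ.≃ dε
  dε≃ = ℚᵘ.≃-trans (ℚ.toℚᵘ-homo-* (fromℕ (suc d)) ε) (ℚᵘ.*-cong (toℚᵘ-/ (suc d) 0) ℚᵘ.≃-refl)
  denominator≤numerator : ℚᵘ.↧ dε ℤ.≤ ℚᵘ.↥ dε
  denominator≤numerator = subst₂ ℤ._≤_ (cong (λ x → + suc x) (sym (ℕ.+-identityʳ d))) (ℤ.pos-* (suc d) (suc n))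
    (ℤ.+≤+ (ℕ.m≤m*n (suc d) (suc n)))
  1≤dε : ℚᵘ.mkℚᵘ (+ 1) 0 ℚᵘ.≤ dε
  1≤dε = ℚᵘ.*≤* (subst₂ ℤ._≤_ (sym (ℤ.*-identityˡ (ℚᵘ.↧ dε))) (sym (ℤ.*-identityʳ (ℚᵘ.↥ dε)))
                             denominator≤numerator)
archimedean₁ (mkℚ (+ zero) _ _) 0<ε with () ← ℚ.positive 0<ε
archimedean₁ (mkℚ ℤ.-[1+ _ ] _ _) 0<ε with () ← ℚ.positive 0<ε

archimedean : ∀ B ε → 0ℚ <ℚ ε → ∃[ T₀ ] ∀ T → T₀ ≤ T → fromℕ B <ℚ fromℕ (suc T) ⊗ ε
archimedean B ε 0<ε with archimedean₁ ε 0<ε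
... | d , 1≤dε = suc B * suc d , λ T B'd≤T → begin-strict
  fromℕ B                              <⟨ B<1+B ⟩
  fromℕ (suc B)                        ≡⟨ ℚ.*-identityʳ (fromℕ (suc B)) ⟨
  fromℕ (suc B) ⊗ 1ℚ                   ≤⟨ *-monoˡ-≤-0≤ (fromℕ (suc B)) (0≤fromℕ (suc B)) 1≤dε ⟩
  fromℕ (suc B) ⊗ (fromℕ (suc d) ⊗ ε)  ≡⟨ ℚ.*-assoc (fromℕ (suc B)) (fromℕ (suc d)) ε ⟨
  fromℕ (suc B) ⊗ fromℕ (suc d) ⊗ ε    ≡⟨ cong (_⊗ ε) (fromℕ-* (suc B) (suc d)) ⟨
  fromℕ (suc B * suc d) ⊗ ε            ≤⟨ *-monoʳ-≤-0≤ ε (ℚ.<⇒≤ 0<ε) (fromℕ-mono-≤ (ℕ.m≤n⇒m≤1+n B'd≤T)) ⟩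
  fromℕ (suc T) ⊗ ε                    ∎
  where
  open ℚ.≤-Reasoning
  B<1+B : fromℕ B <ℚ fromℕ (suc B)
  B<1+B = begin-strict
    fromℕ B        ≡⟨ ℚ.+-identityˡ (fromℕ B) ⟨
    0ℚ ⊕ fromℕ B   <⟨ ℚ.+-monoˡ-< (fromℕ B) (ℚ.positive⁻¹ 1ℚ) ⟩
    1ℚ ⊕ fromℕ B   ≡⟨ fromℕ-+ 1 B ⟨
    fromℕ (suc B)  ∎

TendsToZero : (ℕ → ℚ) → Set
TendsToZero x = ∀ ε → 0ℚ <ℚ ε → ∃[ T₀ ] ∀ T → T₀ ≤ T → x T <ℚ ε

square-bounded⇒linear-tendsToZero : ∀ (x : ℕ → ℚ) C →
  (∀ T → fromℕ (suc T) ⊗ x T ⊗ fromℕ (suc T) ≤ℚ fromℕ C) →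
  TendsToZero (λ T → fromℕ (suc T) ⊗ x T)
square-bounded⇒linear-tendsToZero x C bounded ε 0<ε =
  proj₁ arch , λ T T₀≤T → Tx<ε T (proj₂ arch T T₀≤T)
  where
  open ℚ.≤-Reasoning
  arch = archimedean C ε 0<ε
  Tx<ε : ∀ T → fromℕ C <ℚ fromℕ (suc T) ⊗ ε → fromℕ (suc T) ⊗ x T <ℚ ε
  Tx<ε T C<Tε with fromℕ (suc T) ⊗ x T ℚ.<? ε
  ... | yes Tx<ε = Tx<ε
  ... | no Tx≮ε = ⊥-elim (ℚ.<-irrefl refl (begin-strict
    ε ⊗ fromℕ (suc T)                   ≤⟨ *-monoʳ-≤-0≤ (fromℕ (suc T)) (0≤fromℕ (suc T)) (ℚ.≮⇒≥ Tx≮ε) ⟩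
    fromℕ (suc T) ⊗ x T ⊗ fromℕ (suc T) ≤⟨ bounded T ⟩
    fromℕ C                             <⟨ C<Tε ⟩
    fromℕ (suc T) ⊗ ε                   ≡⟨ ℚ.*-comm (fromℕ (suc T)) ε ⟩
    ε ⊗ fromℕ (suc T)                   ∎))

seriesConvergesTo-if-error-tendsToZero : ∀ f v (δ : ℕ → ℚ) →
  (∀ T → ℚ.∣ sumBelow (suc T) f ⊖ v ∣ ≤ℚ δ T) → TendsToZero δ → SeriesConvergesTo f v
seriesConvergesTo-if-error-tendsToZero f v δ error≤δ δ→0 ε 0<ε with δ→0 ε 0<ε
... | T₀ , δ<ε = suc T₀ , λ where
  (suc T) (s≤s T₀≤T) → ℚ.≤-<-trans (error≤δ T) (δ<ε T T₀≤T)

module _ (G B : ℕ) (M : ℕ → ℚ) (0≤M : ∀ t → 0ℚ ≤ℚ M t) (M0≤B : M 0 ≤ℚ fromℕ B)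
         (decay : ∀ t → fromℕ (suc G) ⊗ M (suc t) ≤ℚ fromℕ G ⊗ M t) where

  -- (a+t)(a+t+1) with a = 2(G+1) grows by a factor at most (G+1)/G per step,
  -- so the geometric decay of M beats it.
  private
    D : ℕ → ℕ
    D t = (2 * suc G + t) * (2 * suc G + t + 1)

    G*D[1+t]≤[1+G]*D[t] : ∀ t → G * D (suc t) ≤ suc G * D t
    G*D[1+t]≤[1+G]*D[t] t = subst (G * D (suc t) ≤_) (sym (expand G t)) (ℕ.m≤m+n _ _)
      where
      expand : ∀ G t → suc G * ((2 * suc G + t) * (2 * suc G + t + 1))
                     ≡ G * ((2 * suc G + suc t) * (2 * suc G + suc t + 1)) + (2 * suc G + t + 1) * (t + 2)
      expand = ℕ-Solver.solve-∀

    H>0 : ℚ.Positive (fromℕ (suc G))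
    H>0 = ℚ.positive (ℚ.<-≤-trans (ℚ.positive⁻¹ 1ℚ) (fromℕ-mono-≤ {1} {suc G} (s≤s z≤n)))

    M*D-antitone : ∀ t → M t ⊗ fromℕ (D t) ≤ℚ M 0 ⊗ fromℕ (D 0)
    M*D-antitone zero = ℚ.≤-refl
    M*D-antitone (suc t) = ℚ.*-cancelˡ-≤-pos H {{H>0}} (begin
      H ⊗ (M (suc t) ⊗ fromℕ (D (suc t)))  ≡⟨ ℚ.*-assoc H _ _ ⟨
      H ⊗ M (suc t) ⊗ fromℕ (D (suc t))    ≤⟨ *-monoʳ-≤-0≤ (fromℕ (D (suc t))) (0≤fromℕ (D (suc t))) (decay t) ⟩
      fromℕ G ⊗ M t ⊗ fromℕ (D (suc t))    ≡⟨ solve 3 (λ g x d → g :* x :* d := x :* (g :* d)) refl (fromℕ G) (M t) _ ⟩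
      M t ⊗ (fromℕ G ⊗ fromℕ (D (suc t)))  ≡⟨ cong (M t ⊗_) (fromℕ-* G (D (suc t))) ⟨
      M t ⊗ fromℕ (G * D (suc t))          ≤⟨ *-monoˡ-≤-0≤ (M t) (0≤M t) (fromℕ-mono-≤ (G*D[1+t]≤[1+G]*D[t] t)) ⟩
      M t ⊗ fromℕ (suc G * D t)            ≡⟨ cong (M t ⊗_) (fromℕ-* (suc G) (D t)) ⟩
      M t ⊗ (H ⊗ fromℕ (D t))              ≡⟨ solve 3 (λ x h d → x :* (h :* d) := h :* (x :* d)) refl (M t) H _ ⟩
      H ⊗ (M t ⊗ fromℕ (D t))              ≤⟨ *-monoˡ-≤-0≤ H (0≤fromℕ (suc G)) (M*D-antitone t) ⟩
      H ⊗ (M 0 ⊗ fromℕ (D 0))              ∎)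
      where
      open ℚ.≤-Reasoning
      H = fromℕ (suc G)

    square-weighted-bounded : ∀ T → fromℕ (suc T) ⊗ M T ⊗ fromℕ (suc T) ≤ℚ fromℕ (B * D 0)
    square-weighted-bounded T = begin
      fromℕ (suc T) ⊗ M T ⊗ fromℕ (suc T)  ≡⟨ solve 2 (λ s x → s :* x :* s := x :* (s :* s)) refl (fromℕ (suc T)) (M T) ⟩
      M T ⊗ (fromℕ (suc T) ⊗ fromℕ (suc T)) ≡⟨ cong (M T ⊗_) (fromℕ-* (suc T) (suc T)) ⟨
      M T ⊗ fromℕ (suc T * suc T)          ≤⟨ *-monoˡ-≤-0≤ (M T) (0≤M T) (fromℕ-mono-≤ (ℕ.*-mono-≤ 1+T≤a+T 1+T≤a+T+1)) ⟩
      M T ⊗ fromℕ (D T)                    ≤⟨ M*D-antitone T ⟩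
      M 0 ⊗ fromℕ (D 0)                    ≤⟨ *-monoʳ-≤-0≤ (fromℕ (D 0)) (0≤fromℕ (D 0)) M0≤B ⟩
      fromℕ B ⊗ fromℕ (D 0)                ≡⟨ fromℕ-* B (D 0) ⟨
      fromℕ (B * D 0)                      ∎
      where
      open ℚ.≤-Reasoning
      1+T≤a+T : suc T ≤ 2 * suc G + T
      1+T≤a+T = ℕ.+-monoˡ-≤ T (s≤s z≤n)
      1+T≤a+T+1 : suc T ≤ 2 * suc G + T + 1
      1+T≤a+T+1 = ℕ.≤-trans 1+T≤a+T (ℕ.m≤m+n _ 1)

  geometric⇒linear-weighted-tendsToZero : TendsToZero (λ T → fromℕ (suc T) ⊗ M T)
  geometric⇒linear-weighted-tendsToZero =
    square-bounded⇒linear-tendsToZero M (B * D 0) square-weighted-bounded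

𝟙 : Bool → ℚ
𝟙 b = if b then 1ℚ else 0ℚ

𝟙⁺ : ℕ → ℚ
𝟙⁺ zero    = 0ℚ
𝟙⁺ (suc _) = 1ℚ

0≤if : ∀ b {x} → 0ℚ ≤ℚ x → 0ℚ ≤ℚ (if b then x else 0ℚ)
0≤if true  0≤x = 0≤x
0≤if false _   = ℚ.≤-refl

0≤𝟙 : ∀ b → 0ℚ ≤ℚ 𝟙 b
0≤𝟙 b = 0≤if b (ℚ.<⇒≤ (ℚ.positive⁻¹ 1ℚ))

⌊⌋-true : ∀ {A : Set} (a? : Dec A) → A → ⌊ a? ⌋ ≡ true
⌊⌋-true a? a = trans (isYes≗does a?) (dec-true a? a)

⌊⌋-false : ∀ {A : Set} (a? : Dec A) → ¬ A → ⌊ a? ⌋ ≡ false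
⌊⌋-false a? ¬a = trans (isYes≗does a?) (dec-false a? ¬a)

==-refl : ∀ a → (a == a) ≡ true
==-refl a = ⌊⌋-true (a ≟ a) refl

==-≢ : ∀ {a b} → ¬ a ≡ b → (a == b) ≡ false
==-≢ {a} {b} = ⌊⌋-false (a ≟ b)

==⇒≡ : ∀ {a b} → (a == b) ≡ true → a ≡ b
==⇒≡ {a} {b} a==b with a ≟ b
... | yes a≡b = a≡b
... | no _ with () ← a==b

==-suc : ∀ a b → (suc a == suc b) ≡ (a == b)
==-suc a b with a ≟ b
... | yes a≡b = ⌊⌋-true (suc a ≟ suc b) (cong suc a≡b)
... | no a≢b = ⌊⌋-false (suc a ≟ suc b) (a≢b ∘ ℕ.suc-injective)

if-disjoint : ∀ (b₁ b₂ b₃ : Bool) (x y z : ℚ) →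
  (b₁ ≡ true → b₂ ≡ false) → (b₁ ≡ true → b₃ ≡ false) → (b₂ ≡ true → b₃ ≡ false) →
  (if b₁ then x else if b₂ then y else if b₃ then z else 0ℚ) ≡ 𝟙 b₁ ⊗ x ⊕ (𝟙 b₂ ⊗ y ⊕ 𝟙 b₃ ⊗ z)
if-disjoint true  true  _     x y z ¬₁₂ _   _   with () ← ¬₁₂ refl
if-disjoint true  false true  x y z _   ¬₁₃ _   with () ← ¬₁₃ refl
if-disjoint false true  true  x y z _   _   ¬₂₃ with () ← ¬₂₃ refl
if-disjoint true  false false x y z _ _ _ =
  solve 3 (λ x y z → x := con 1ℚ :* x :+ (con 0ℚ :* y :+ con 0ℚ :* z)) refl x y z
if-disjoint false true  false x y z _ _ _ =
  solve 3 (λ x y z → y := con 0ℚ :* x :+ (con 1ℚ :* y :+ con 0ℚ :* z)) refl x y z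
if-disjoint false false true  x y z _ _ _ =
  solve 3 (λ x y z → z := con 0ℚ :* x :+ (con 0ℚ :* y :+ con 1ℚ :* z)) refl x y z
if-disjoint false false false x y z _ _ _ =
  solve 3 (λ x y z → con 0ℚ := con 0ℚ :* x :+ (con 0ℚ :* y :+ con 0ℚ :* z)) refl x y z

sum1to-cong : ∀ n {f g : ℕ → ℚ} → (∀ i → 1 ≤ i → i ≤ n → f i ≡ g i) → sum1to n f ≡ sum1to n g
sum1to-cong zero    f≡g = refl
sum1to-cong (suc n) f≡g =
  cong₂ _⊕_ (sum1to-cong n (λ i 1≤i i≤n → f≡g i 1≤i (ℕ.m≤n⇒m≤1+n i≤n))) (f≡g (suc n) (s≤s z≤n) ℕ.≤-refl)

sum1to-zero : ∀ n → sum1to n (λ _ → 0ℚ) ≡ 0ℚ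
sum1to-zero zero    = refl
sum1to-zero (suc n) = cong (_⊕ 0ℚ) (sum1to-zero n)

sum1to-+ : ∀ n (f g : ℕ → ℚ) → sum1to n (λ i → f i ⊕ g i) ≡ sum1to n f ⊕ sum1to n g
sum1to-+ zero    f g = refl
sum1to-+ (suc n) f g rewrite sum1to-+ n f g =
  solve 4 (λ A B x y → (A :+ B) :+ (x :+ y) := (A :+ x) :+ (B :+ y)) refl (sum1to n f) (sum1to n g) (f (suc n)) (g (suc n))

sum1to-- : ∀ n (f g : ℕ → ℚ) → sum1to n (λ i → f i ⊖ g i) ≡ sum1to n f ⊖ sum1to n g
sum1to-- zero    f g = refl
sum1to-- (suc n) f g rewrite sum1to-- n f g =
  solve 4 (λ A B x y → (A :- B) :+ (x :- y) := (A :+ x) :- (B :+ y)) refl (sum1to n f) (sum1to n g) (f (suc n)) (g (suc n))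

sum1to-*ˡ : ∀ n c (f : ℕ → ℚ) → sum1to n (λ i → c ⊗ f i) ≡ c ⊗ sum1to n f
sum1to-*ˡ zero    c f = sym (ℚ.*-zeroʳ c)
sum1to-*ˡ (suc n) c f rewrite sum1to-*ˡ n c f = sym (ℚ.*-distribˡ-+ c (sum1to n f) (f (suc n)))

sum1to-*ʳ : ∀ n c (f : ℕ → ℚ) → sum1to n (λ i → f i ⊗ c) ≡ sum1to n f ⊗ c
sum1to-*ʳ zero    c f = sym (ℚ.*-zeroˡ c)
sum1to-*ʳ (suc n) c f rewrite sum1to-*ʳ n c f = sym (ℚ.*-distribʳ-+ c (sum1to n f) (f (suc n)))

sum1to-comm : ∀ n m (F : ℕ → ℕ → ℚ) →
  sum1to n (λ j → sum1to m (λ i → F i j)) ≡ sum1to m (λ i → sum1to n (λ j → F i j))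
sum1to-comm zero    m F = sym (sum1to-zero m)
sum1to-comm (suc n) m F rewrite sum1to-comm n m F = sym (sum1to-+ m (λ i → sum1to n (λ j → F i j)) (λ i → F i (suc n)))

sum1to-mono-≤ : ∀ n (f g : ℕ → ℚ) → (∀ i → 1 ≤ i → i ≤ n → f i ≤ℚ g i) → sum1to n f ≤ℚ sum1to n g
sum1to-mono-≤ zero    f g f≤g = ℚ.≤-refl
sum1to-mono-≤ (suc n) f g f≤g =
  ℚ.+-mono-≤ (sum1to-mono-≤ n f g (λ i 1≤i i≤n → f≤g i 1≤i (ℕ.m≤n⇒m≤1+n i≤n))) (f≤g (suc n) (s≤s z≤n) ℕ.≤-refl)

sum1to-nonNeg : ∀ n (f : ℕ → ℚ) → (∀ i → 1 ≤ i → i ≤ n → 0ℚ ≤ℚ f i) → 0ℚ ≤ℚ sum1to n f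
sum1to-nonNeg n f 0≤f = subst (_≤ℚ sum1to n f) (sum1to-zero n) (sum1to-mono-≤ n (λ _ → 0ℚ) f 0≤f)

sum1to-𝟙-outside : ∀ n c (g : ℕ → ℚ) → n < c → sum1to n (λ j → 𝟙 (j == c) ⊗ g j) ≡ 0ℚ
sum1to-𝟙-outside n c g n<c = trans (sum1to-cong n vanish) (sum1to-zero n)
  where
  vanish : ∀ j → 1 ≤ j → j ≤ n → 𝟙 (j == c) ⊗ g j ≡ 0ℚ
  vanish j _ j≤n rewrite ==-≢ (ℕ.<⇒≢ (ℕ.≤-<-trans j≤n n<c)) = ℚ.*-zeroˡ (g j)

-- The hypothesis g 0 ≡ 0 covers c = 0, which lies outside the summation range 1..n.
sum1to-𝟙 : ∀ n c (g : ℕ → ℚ) → c ≤ n → g 0 ≡ 0ℚ → sum1to n (λ j → 𝟙 (j == c) ⊗ g j) ≡ g c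
sum1to-𝟙 zero .zero g z≤n g0≡0 = sym g0≡0
sum1to-𝟙 (suc n) c g c≤1+n g0≡0 with ℕ.m≤n⇒m<n∨m≡n c≤1+n
... | inj₂ refl rewrite sum1to-𝟙-outside n (suc n) g ℕ.≤-refl | ==-refl (suc n) =
  trans (ℚ.+-identityˡ _) (ℚ.*-identityˡ (g (suc n)))
... | inj₁ (s≤s c≤n) rewrite sum1to-𝟙 n c g c≤n g0≡0 | ==-≢ (ℕ.<⇒≢ (s≤s c≤n) ∘ sym) =
  trans (cong (g c ⊕_) (ℚ.*-zeroˡ (g (suc n)))) (ℚ.+-identityʳ (g c))

sumFromTo-empty : ∀ a b f → b < a → sumFromTo a b f ≡ 0
sumFromTo-empty a zero    f b<a rewrite ⌊⌋-false (a ≤? 0) (ℕ.<⇒≱ b<a) = refl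
sumFromTo-empty a (suc b) f b<a rewrite ⌊⌋-false (a ≤? suc b) (ℕ.<⇒≱ b<a) =
  trans (ℕ.+-identityʳ _) (sumFromTo-empty a b f (ℕ.<-trans (ℕ.n<1+n b) b<a))

sumFromTo-head : ∀ a b f → a ≤ b → sumFromTo a b f ≡ f a + sumFromTo (suc a) b f
sumFromTo-head .zero zero f z≤n = sym (ℕ.+-identityʳ (f 0))
sumFromTo-head a (suc b) f a≤1+b with ℕ.m≤n⇒m<n∨m≡n a≤1+b
... | inj₂ refl
  rewrite sumFromTo-empty (suc b) b f (ℕ.n<1+n b) | sumFromTo-empty (suc (suc b)) (suc b) f (ℕ.n<1+n (suc b))
        | ⌊⌋-true (suc b ≤? suc b) ℕ.≤-refl = sym (ℕ.+-identityʳ (f (suc b)))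
... | inj₁ (s≤s a≤b)
  rewrite sumFromTo-head a b f a≤b | ⌊⌋-true (a ≤? suc b) (ℕ.m≤n⇒m≤1+n a≤b) | ⌊⌋-true (suc a ≤? suc b) (s≤s a≤b) =
  ℕ.+-assoc (f a) (sumFromTo (suc a) b f) (f (suc b))

m∸n≡1+m∸[1+n] : ∀ {m} n → suc n ≤ m → m ∸ n ≡ suc (m ∸ suc n)
m∸n≡1+m∸[1+n] n = ℕ.+-∸-assoc 1

α-step : ∀ n → fromℕ (α (suc n)) ≡ 1ℚ ⊕ fromℕ n ⊗ fromℕ (α n)
α-step n = trans (fromℕ-+ 1 (n * α n)) (cong (1ℚ ⊕_) (fromℕ-* n (α n)))

first-step-identity : ∀ q u A K n a → u ≡ n ⊗ q → q ⊗ K ≡ 1ℚ →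
  let X = A ⊕ K ⊗ (1ℚ ⊕ n ⊗ a) in q ⊗ A ⊕ (u ⊗ (X ⊕ K ⊗ a) ⊕ (1ℚ ⊖ q ⊖ u) ⊗ X) ≡ X ⊖ 1ℚ
first-step-identity q .(n ⊗ q) A K n a refl qK≡1 = begin
  q ⊗ A ⊕ (n ⊗ q ⊗ (X ⊕ K ⊗ a) ⊕ (1ℚ ⊖ q ⊖ n ⊗ q) ⊗ X) ≡⟨ solve 5 (λ q A K n a →
      q :* A :+ (n :* q :* ((A :+ K :* (con 1ℚ :+ n :* a)) :+ K :* a) :+ (con 1ℚ :- q :- n :* q) :* (A :+ K :* (con 1ℚ :+ n :* a)))
      := ((A :+ K :* (con 1ℚ :+ n :* a)) :- con 1ℚ) :+ (con 1ℚ :- q :* K)) refl q A K n a ⟩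
  (X ⊖ 1ℚ) ⊕ (1ℚ ⊖ q ⊗ K)                              ≡⟨ cong (λ x → (X ⊖ 1ℚ) ⊕ (1ℚ ⊖ x)) qK≡1 ⟩
  (X ⊖ 1ℚ) ⊕ (1ℚ ⊖ 1ℚ)                                 ≡⟨ cong ((X ⊖ 1ℚ) ⊕_) (ℚ.+-inverseʳ 1ℚ) ⟩
  (X ⊖ 1ℚ) ⊕ 0ℚ                                        ≡⟨ ℚ.+-identityʳ (X ⊖ 1ℚ) ⟩
  X ⊖ 1ℚ                                               ∎
  where
  open ≡-Reasoning
  X = A ⊕ K ⊗ (1ℚ ⊕ n ⊗ a)

module HarmonicChain (m : ℕ) where

  k : ℕ
  k = suc m

  down : ℚ
  down = frac 1 k

  up : ℕ → ℚ
  up i = frac (k ∸ suc i) k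

  stay : ℕ → ℚ
  stay i = 1ℚ ⊖ down ⊖ up i

  P-suc : ∀ i j → P k (suc i) j ≡ 𝟙 (j == i) ⊗ down ⊕ (𝟙 (j == suc (suc i)) ⊗ up i ⊕ 𝟙 (j == suc i) ⊗ stay i)
  P-suc i j =
    trans (if-disjoint (suc j == suc i) (j == suc (suc i)) (j == suc i) down (up i) (stay i)
                       ¬down∧up ¬down∧stay ¬up∧stay)
          (cong (λ b → 𝟙 b ⊗ down ⊕ (𝟙 (j == suc (suc i)) ⊗ up i ⊕ 𝟙 (j == suc i) ⊗ stay i)) (==-suc j i))
    where
    ¬down∧up : (suc j == suc i) ≡ true → (j == suc (suc i)) ≡ false
    ¬down∧up j=i = ==-≢ λ j=2+i → ℕ.<⇒≢ (ℕ.m<n⇒m<1+n (ℕ.n<1+n i)) (trans (sym (ℕ.suc-injective (==⇒≡ j=i))) j=2+i)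
    ¬down∧stay : (suc j == suc i) ≡ true → (j == suc i) ≡ false
    ¬down∧stay j=i = ==-≢ λ j=1+i → ℕ.<⇒≢ (ℕ.n<1+n i) (trans (sym (ℕ.suc-injective (==⇒≡ j=i))) j=1+i)
    ¬up∧stay : (j == suc (suc i)) ≡ true → (j == suc i) ≡ false
    ¬up∧stay j=2+i = ==-≢ λ j=1+i → ℕ.<⇒≢ (ℕ.n<1+n (suc i)) (trans (sym j=1+i) (==⇒≡ j=2+i))

  P-suc-expectation : ∀ (f : ℕ → ℚ) → f 0 ≡ 0ℚ → ∀ i → suc i ≤ k →
    sum1to k (λ j → P k (suc i) j ⊗ f j) ≡ down ⊗ f i ⊕ (up i ⊗ f (suc (suc i)) ⊕ stay i ⊗ f (suc i))
  P-suc-expectation f f0≡0 i 1+i≤k = begin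
    sum1to k (λ j → P k (suc i) j ⊗ f j)                         ≡⟨ sum1to-cong k (λ j _ _ → split j) ⟩
    sum1to k (λ j → toDown j ⊕ (toUp j ⊕ toStay j))              ≡⟨ sum1to-+ k toDown _ ⟩
    sum1to k toDown ⊕ sum1to k (λ j → toUp j ⊕ toStay j)         ≡⟨ cong (sum1to k toDown ⊕_) (sum1to-+ k toUp toStay) ⟩
    sum1to k toDown ⊕ (sum1to k toUp ⊕ sum1to k toStay)          ≡⟨ cong₂ _⊕_ down-term (cong₂ _⊕_ up-term stay-term) ⟩
    down ⊗ f i ⊕ (up i ⊗ f (suc (suc i)) ⊕ stay i ⊗ f (suc i))  ∎
    where
    open ≡-Reasoning
    toDown toUp toStay : ℕ → ℚ
    toDown j = 𝟙 (j == i) ⊗ (down ⊗ f j)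
    toUp   j = 𝟙 (j == suc (suc i)) ⊗ (up i ⊗ f j)
    toStay j = 𝟙 (j == suc i) ⊗ (stay i ⊗ f j)
    split : ∀ j → P k (suc i) j ⊗ f j ≡ toDown j ⊕ (toUp j ⊕ toStay j)
    split j = trans (cong (_⊗ f j) (P-suc i j))
      (solve 7 (λ b₁ b₂ b₃ x y z w → (b₁ :* x :+ (b₂ :* y :+ b₃ :* z)) :* w
                                    := b₁ :* (x :* w) :+ (b₂ :* (y :* w) :+ b₃ :* (z :* w)))
             refl (𝟙 (j == i)) (𝟙 (j == suc (suc i))) (𝟙 (j == suc i)) down (up i) (stay i) (f j))
    c*f0≡0 : ∀ c → c ⊗ f 0 ≡ 0ℚ
    c*f0≡0 c = trans (cong (c ⊗_) f0≡0) (ℚ.*-zeroʳ c)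
    down-term : sum1to k toDown ≡ down ⊗ f i
    down-term = sum1to-𝟙 k i (λ j → down ⊗ f j) (ℕ.<⇒≤ 1+i≤k) (c*f0≡0 down)
    stay-term : sum1to k toStay ≡ stay i ⊗ f (suc i)
    stay-term = sum1to-𝟙 k (suc i) (λ j → stay i ⊗ f j) 1+i≤k (c*f0≡0 (stay i))
    up-term : sum1to k toUp ≡ up i ⊗ f (suc (suc i))
    up-term with suc (suc i) ≤? k
    ... | yes 2+i≤k = sum1to-𝟙 k (suc (suc i)) (λ j → up i ⊗ f j) 2+i≤k (c*f0≡0 (up i))
    -- here i + 1 = k, so the up-move has probability (k − k)/k = 0
    ... | no 2+i≰k = trans (sum1to-𝟙-outside k (suc (suc i)) (λ j → up i ⊗ f j) k<2+i) (sym up≡0)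
      where
      k<2+i : k < suc (suc i)
      k<2+i = ℕ.≰⇒> 2+i≰k
      up≡0 : up i ⊗ f (suc (suc i)) ≡ 0ℚ
      up≡0 rewrite ℕ.suc-injective (ℕ.≤-antisym 1+i≤k (ℕ.≤-pred k<2+i)) | ℕ.n∸n≡0 m | ℚ.0/n≡0 k {{_}} =
        ℚ.*-zeroˡ (f (suc k))

  stay≡i*down : ∀ i → suc i ≤ k → stay i ≡ fromℕ i ⊗ down
  stay≡i*down i 1+i≤k = begin
    1ℚ ⊖ down ⊖ up i                                         ≡⟨ cong (1ℚ ⊖ down ⊖_) (frac≡fromℕ*frac1 n m) ⟩
    1ℚ ⊖ down ⊖ fromℕ n ⊗ down                               ≡⟨ solve 3 (λ i n q → con 1ℚ :- q :- n :* q
                                                                                 := i :* q :+ (con 1ℚ :- (con 1ℚ :+ (i :+ n)) :* q))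
                                                                        refl (fromℕ i) (fromℕ n) down ⟩
    fromℕ i ⊗ down ⊕ (1ℚ ⊖ (1ℚ ⊕ (fromℕ i ⊕ fromℕ n)) ⊗ down) ≡⟨ cong (λ x → fromℕ i ⊗ down ⊕ (1ℚ ⊖ x ⊗ down)) 1+i+n≡k ⟩
    fromℕ i ⊗ down ⊕ (1ℚ ⊖ fromℕ k ⊗ down)                   ≡⟨ cong (λ x → fromℕ i ⊗ down ⊕ (1ℚ ⊖ x)) (fromℕ*frac1≡1 m) ⟩
    fromℕ i ⊗ down ⊕ (1ℚ ⊖ 1ℚ)                               ≡⟨ cong (fromℕ i ⊗ down ⊕_) (ℚ.+-inverseʳ 1ℚ) ⟩
    fromℕ i ⊗ down ⊕ 0ℚ                                      ≡⟨ ℚ.+-identityʳ (fromℕ i ⊗ down) ⟩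
    fromℕ i ⊗ down                                           ∎
    where
    open ≡-Reasoning
    n = k ∸ suc i
    1+i+n≡k : 1ℚ ⊕ (fromℕ i ⊕ fromℕ n) ≡ fromℕ k
    1+i+n≡k = begin
      1ℚ ⊕ (fromℕ i ⊕ fromℕ n)  ≡⟨ cong (1ℚ ⊕_) (fromℕ-+ i n) ⟨
      1ℚ ⊕ fromℕ (i + n)        ≡⟨ fromℕ-+ 1 (i + n) ⟨
      fromℕ (suc i + n)         ≡⟨ cong fromℕ (ℕ.m+[n∸m]≡n 1+i≤k) ⟩
      fromℕ k                   ∎

  P-nonNeg : ∀ i j → 1 ≤ i → i ≤ k → 0ℚ ≤ℚ P k i j
  P-nonNeg (suc i) j _ 1+i≤k = subst (0ℚ ≤ℚ_) (sym (P-suc i j))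
    (0≤+ (0≤* (0≤𝟙 (j == i)) (0≤frac 1 m))
         (0≤+ (0≤* (0≤𝟙 (j == suc (suc i))) (0≤frac (k ∸ suc i) m)) (0≤* (0≤𝟙 (j == suc i)) 0≤stay)))
    where
    0≤stay : 0ℚ ≤ℚ stay i
    0≤stay = subst (0ℚ ≤ℚ_) (sym (stay≡i*down i 1+i≤k)) (0≤* (0≤fromℕ i) (0≤frac 1 m))

  P-row-sum : ∀ i → suc i ≤ k → sum1to k (P k (suc i)) ⊕ P k (suc i) 0 ≡ 1ℚ
  P-row-sum i 1+i≤k = trans (cong (_⊕ P k (suc i) 0) (trans (sum1to-cong k weigh) (P-suc-expectation 𝟙⁺ refl i 1+i≤k)))
                            (total i)
    where
    weigh : ∀ j → 1 ≤ j → j ≤ k → P k (suc i) j ≡ P k (suc i) j ⊗ 𝟙⁺ j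
    weigh (suc j) _ _ = sym (ℚ.*-identityʳ (P k (suc i) (suc j)))
    total : ∀ i → down ⊗ 𝟙⁺ i ⊕ (up i ⊗ 1ℚ ⊕ stay i ⊗ 1ℚ) ⊕ P k (suc i) 0 ≡ 1ℚ
    total zero =
      solve 2 (λ q u → q :* con 0ℚ :+ (u :* con 1ℚ :+ (con 1ℚ :- q :- u) :* con 1ℚ) :+ q := con 1ℚ) refl down (up 0)
    total (suc i) =
      solve 2 (λ q u → q :* con 1ℚ :+ (u :* con 1ℚ :+ (con 1ℚ :- q :- u) :* con 1ℚ) :+ con 0ℚ := con 1ℚ)
              refl down (up (suc i))

  -- The recursion α_{n+1} = 1 + n α_n is exactly what makes h solve (P h)(i) = h(i) − 1.
  h : ℕ → ℕ
  h zero    = 0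
  h (suc j) = h j + k * α (k ∸ j)

  h-step : ∀ j → fromℕ (h (suc j)) ≡ fromℕ (h j) ⊕ fromℕ k ⊗ fromℕ (α (k ∸ j))
  h-step j = trans (fromℕ-+ (h j) (k * α (k ∸ j))) (cong (fromℕ (h j) ⊕_) (fromℕ-* k (α (k ∸ j))))

  h-harmonic : ∀ i → suc i ≤ k → sum1to k (λ j → P k (suc i) j ⊗ fromℕ (h j)) ≡ fromℕ (h (suc i)) ⊖ 1ℚ
  h-harmonic i 1+i≤k = begin
    sum1to k (λ j → P k (suc i) j ⊗ fromℕ (h j))
      ≡⟨ P-suc-expectation (fromℕ ∘ h) refl i 1+i≤k ⟩
    down ⊗ fromℕ (h i) ⊕ (up i ⊗ fromℕ (h (suc (suc i))) ⊕ stay i ⊗ fromℕ (h (suc i)))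
      ≡⟨ cong₂ (λ y x → down ⊗ fromℕ (h i) ⊕ (up i ⊗ y ⊕ stay i ⊗ x)) h[2+i] h[1+i] ⟩
    down ⊗ fromℕ (h i) ⊕ (up i ⊗ (X ⊕ fromℕ k ⊗ a) ⊕ stay i ⊗ X)
      ≡⟨ first-step-identity down (up i) (fromℕ (h i)) (fromℕ k) (fromℕ n) a (frac≡fromℕ*frac1 n m) down*k≡1 ⟩
    X ⊖ 1ℚ
      ≡⟨ cong (_⊖ 1ℚ) h[1+i] ⟨
    fromℕ (h (suc i)) ⊖ 1ℚ
      ∎
    where
    open ≡-Reasoning
    n = k ∸ suc i
    a = fromℕ (α n)
    X = fromℕ (h i) ⊕ fromℕ k ⊗ (1ℚ ⊕ fromℕ n ⊗ a)
    h[1+i] : fromℕ (h (suc i)) ≡ X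
    h[1+i] = trans (h-step i) (cong (λ x → fromℕ (h i) ⊕ fromℕ k ⊗ x)
                                    (trans (cong (fromℕ ∘ α) (m∸n≡1+m∸[1+n] i 1+i≤k)) (α-step n)))
    h[2+i] : fromℕ (h (suc (suc i))) ≡ X ⊕ fromℕ k ⊗ a
    h[2+i] = trans (h-step (suc i)) (cong (_⊕ fromℕ k ⊗ a) h[1+i])
    down*k≡1 : down ⊗ fromℕ k ≡ 1ℚ
    down*k≡1 = trans (ℚ.*-comm down (fromℕ k)) (fromℕ*frac1≡1 m)

  h-positive : ∀ j → 1 ≤ j → j ≤ k → 1 ≤ h j
  h-positive (suc j) _ 1+j≤k rewrite m∸n≡1+m∸[1+n] j 1+j≤k = ℕ.≤-trans (s≤s z≤n) (ℕ.m≤n+m _ (h j))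

  h-mono-≤ : ∀ {a b} → a ≤ b → h a ≤ h b
  h-mono-≤ {b = zero} z≤n = ℕ.≤-refl
  h-mono-≤ {a} {suc b} a≤1+b with ℕ.m≤n⇒m<n∨m≡n a≤1+b
  ... | inj₂ refl = ℕ.≤-refl
  ... | inj₁ (s≤s a≤b) = ℕ.≤-trans (h-mono-≤ a≤b) (ℕ.m≤m+n (h b) _)

  h-closed-form : ∀ ℓ → ℓ ≤ k → h ℓ ≡ k * sumFromTo (k ∸ ℓ + 1) k α
  h-closed-form zero _ = sym (trans (cong (k *_) (sumFromTo-empty (k + 1) k α (ℕ.m<m+n k (s≤s z≤n)))) (ℕ.*-zeroʳ k))
  h-closed-form (suc ℓ) 1+ℓ≤k = begin
    h ℓ + k * α (k ∸ ℓ)                                ≡⟨ cong (_+ k * α (k ∸ ℓ)) (h-closed-form ℓ (ℕ.<⇒≤ 1+ℓ≤k)) ⟩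
    k * sumFromTo (k ∸ ℓ + 1) k α + k * α (k ∸ ℓ)      ≡⟨ ℕ.+-comm _ (k * α (k ∸ ℓ)) ⟩
    k * α (k ∸ ℓ) + k * sumFromTo (k ∸ ℓ + 1) k α      ≡⟨ ℕ.*-distribˡ-+ k (α (k ∸ ℓ)) _ ⟨
    k * (α (k ∸ ℓ) + sumFromTo (k ∸ ℓ + 1) k α)        ≡⟨ cong (λ a → k * (α (k ∸ ℓ) + sumFromTo a k α)) (ℕ.+-comm (k ∸ ℓ) 1) ⟩
    k * (α (k ∸ ℓ) + sumFromTo (suc (k ∸ ℓ)) k α)      ≡⟨ cong (k *_) (sumFromTo-head (k ∸ ℓ) k α (ℕ.m∸n≤m k ℓ)) ⟨
    k * sumFromTo (k ∸ ℓ) k α                          ≡⟨ cong (λ a → k * sumFromTo a k α) (m∸n≡1+m∸[1+n] ℓ 1+ℓ≤k) ⟩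
    k * sumFromTo (suc (k ∸ suc ℓ)) k α                ≡⟨ cong (λ a → k * sumFromTo a k α) (ℕ.+-comm 1 (k ∸ suc ℓ)) ⟩
    k * sumFromTo (k ∸ suc ℓ + 1) k α                  ∎
    where open ≡-Reasoning

module Absorption (m ℓ : ℕ) (ℓ≤k : ℓ ≤ suc m) (g : ℕ → ℕ) (G : ℕ) (g0≡0 : g 0 ≡ 0)
  (g-positive : ∀ j → 1 ≤ j → j ≤ suc m → 1 ≤ g j)
  (g-bounded : ∀ j → 1 ≤ j → j ≤ suc m → g j ≤ suc G)
  (g-harmonic : ∀ i → suc i ≤ suc m →
                sum1to (suc m) (λ j → P (suc m) (suc i) j ⊗ fromℕ (g j)) ≡ fromℕ (g (suc i)) ⊖ 1ℚ) where

  open HarmonicChain m using (k; P-nonNeg; P-row-sum)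

  S : ℕ → ℚ
  S t = sum1to k (ν k ℓ t)

  M : ℕ → ℚ
  M t = sum1to k (λ j → ν k ℓ t j ⊗ fromℕ (g j))

  inRange-true : ∀ j → 1 ≤ j → j ≤ k → inRange k j ≡ true
  inRange-true j 1≤j j≤k = cong₂ _∧_ (⌊⌋-true (1 ≤? j) 1≤j) (⌊⌋-true (j ≤? k) j≤k)

  ν-initial : ∀ j → 1 ≤ j → j ≤ k → ν k ℓ 0 j ≡ 𝟙 (j == ℓ)
  ν-initial j 1≤j j≤k rewrite inRange-true j 1≤j j≤k = refl

  0≤ν : ∀ t j → 0ℚ ≤ℚ ν k ℓ t j
  0≤ν zero    j = 0≤𝟙 (inRange k j ∧ (j == ℓ))
  0≤ν (suc t) j = 0≤if (inRange k j) (sum1to-nonNeg k _ (λ i 1≤i i≤k → 0≤* (0≤ν t i) (P-nonNeg i j 1≤i i≤k)))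

  ν-step : ∀ t (f : ℕ → ℚ) →
    sum1to k (λ j → ν k ℓ (suc t) j ⊗ f j) ≡ sum1to k (λ i → ν k ℓ t i ⊗ sum1to k (λ j → P k i j ⊗ f j))
  ν-step t f = begin
    sum1to k (λ j → ν k ℓ (suc t) j ⊗ f j)                    ≡⟨ sum1to-cong k unfold ⟩
    sum1to k (λ j → sum1to k (λ i → ν k ℓ t i ⊗ P k i j ⊗ f j)) ≡⟨ sum1to-comm k k (λ i j → ν k ℓ t i ⊗ P k i j ⊗ f j) ⟩
    sum1to k (λ i → sum1to k (λ j → ν k ℓ t i ⊗ P k i j ⊗ f j)) ≡⟨ sum1to-cong k (λ i _ _ → factor i) ⟩
    sum1to k (λ i → ν k ℓ t i ⊗ sum1to k (λ j → P k i j ⊗ f j)) ∎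
    where
    open ≡-Reasoning
    unfold : ∀ j → 1 ≤ j → j ≤ k → ν k ℓ (suc t) j ⊗ f j ≡ sum1to k (λ i → ν k ℓ t i ⊗ P k i j ⊗ f j)
    unfold j 1≤j j≤k rewrite inRange-true j 1≤j j≤k = sym (sum1to-*ʳ k (f j) (λ i → ν k ℓ t i ⊗ P k i j))
    factor : ∀ i → sum1to k (λ j → ν k ℓ t i ⊗ P k i j ⊗ f j) ≡ ν k ℓ t i ⊗ sum1to k (λ j → P k i j ⊗ f j)
    factor i = trans (sum1to-cong k (λ j _ _ → ℚ.*-assoc (ν k ℓ t i) (P k i j) (f j)))
                     (sum1to-*ˡ k (ν k ℓ t i) (λ j → P k i j ⊗ f j))

  S-step : ∀ t → S (suc t) ≡ S t ⊖ hit k ℓ (suc t)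
  S-step t = begin
    S (suc t)                                                  ≡⟨ sum1to-cong k (λ j _ _ → ℚ.*-identityʳ (ν k ℓ (suc t) j)) ⟨
    sum1to k (λ j → ν k ℓ (suc t) j ⊗ 1ℚ)                      ≡⟨ ν-step t (λ _ → 1ℚ) ⟩
    sum1to k (λ i → ν k ℓ t i ⊗ sum1to k (λ j → P k i j ⊗ 1ℚ)) ≡⟨ sum1to-cong k survive ⟩
    sum1to k (λ i → ν k ℓ t i ⊖ ν k ℓ t i ⊗ P k i 0)           ≡⟨ sum1to-- k (ν k ℓ t) (λ i → ν k ℓ t i ⊗ P k i 0) ⟩
    S t ⊖ hit k ℓ (suc t)                                      ∎
    where
    open ≡-Reasoning
    survive : ∀ i → 1 ≤ i → i ≤ k → ν k ℓ t i ⊗ sum1to k (λ j → P k i j ⊗ 1ℚ) ≡ ν k ℓ t i ⊖ ν k ℓ t i ⊗ P k i 0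
    survive (suc i) _ 1+i≤k = begin
      v ⊗ sum1to k (λ j → P k (suc i) j ⊗ 1ℚ)            ≡⟨ cong (v ⊗_) (sum1to-cong k (λ j _ _ → ℚ.*-identityʳ (P k (suc i) j))) ⟩
      v ⊗ sum1to k (P k (suc i))                          ≡⟨ cong (v ⊗_) (solve 2 (λ x p → x := (x :+ p) :- p) refl _ (P k (suc i) 0)) ⟩
      v ⊗ (sum1to k (P k (suc i)) ⊕ P k (suc i) 0 ⊖ P k (suc i) 0)  ≡⟨ cong (λ x → v ⊗ (x ⊖ P k (suc i) 0)) (P-row-sum i 1+i≤k) ⟩
      v ⊗ (1ℚ ⊖ P k (suc i) 0)                            ≡⟨ solve 2 (λ v p → v :* (con 1ℚ :- p) := v :- v :* p) refl v (P k (suc i) 0) ⟩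
      v ⊖ v ⊗ P k (suc i) 0                               ∎
      where v = ν k ℓ t (suc i)

  M-step : ∀ t → M (suc t) ≡ M t ⊖ S t
  M-step t = begin
    M (suc t)                                                        ≡⟨ ν-step t (fromℕ ∘ g) ⟩
    sum1to k (λ i → ν k ℓ t i ⊗ sum1to k (λ j → P k i j ⊗ fromℕ (g j))) ≡⟨ sum1to-cong k harmonic ⟩
    sum1to k (λ i → ν k ℓ t i ⊗ fromℕ (g i) ⊖ ν k ℓ t i)              ≡⟨ sum1to-- k (λ i → ν k ℓ t i ⊗ fromℕ (g i)) (ν k ℓ t) ⟩
    M t ⊖ S t                                                        ∎
    where
    open ≡-Reasoning
    harmonic : ∀ i → 1 ≤ i → i ≤ k → ν k ℓ t i ⊗ sum1to k (λ j → P k i j ⊗ fromℕ (g j)) ≡ ν k ℓ t i ⊗ fromℕ (g i) ⊖ ν k ℓ t i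
    harmonic (suc i) _ 1+i≤k = trans (cong (ν k ℓ t (suc i) ⊗_) (g-harmonic i 1+i≤k))
      (solve 2 (λ v x → v :* (x :- con 1ℚ) := v :* x :- v) refl (ν k ℓ t (suc i)) (fromℕ (g (suc i))))

  S-initial : hit k ℓ 0 ⊕ S 0 ≡ 1ℚ
  S-initial = trans (cong (hit k ℓ 0 ⊕_) S0≡𝟙⁺ℓ) (survival ℓ)
    where
    S0≡𝟙⁺ℓ : S 0 ≡ 𝟙⁺ ℓ
    S0≡𝟙⁺ℓ = trans (sum1to-cong k (λ where (suc j) 1≤j j≤k → trans (ν-initial (suc j) 1≤j j≤k) (sym (ℚ.*-identityʳ _))))
                   (sum1to-𝟙 k ℓ 𝟙⁺ ℓ≤k refl)
    survival : ∀ ℓ → hit k ℓ 0 ⊕ 𝟙⁺ ℓ ≡ 1ℚ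
    survival zero    = refl
    survival (suc _) = refl

  M-initial : M 0 ≡ fromℕ (g ℓ)
  M-initial = trans (sum1to-cong k (λ j 1≤j j≤k → cong (_⊗ fromℕ (g j)) (ν-initial j 1≤j j≤k)))
                    (sum1to-𝟙 k ℓ (fromℕ ∘ g) ℓ≤k (cong fromℕ g0≡0))

  hit-partialSum : ∀ T → sumBelow (suc T) (hit k ℓ) ≡ 1ℚ ⊖ S T
  hit-partialSum zero = begin
    0ℚ ⊕ hit k ℓ 0               ≡⟨ solve 2 (λ h s → con 0ℚ :+ h := (h :+ s) :- s) refl (hit k ℓ 0) (S 0) ⟩
    (hit k ℓ 0 ⊕ S 0) ⊖ S 0      ≡⟨ cong (_⊖ S 0) S-initial ⟩
    1ℚ ⊖ S 0                     ∎
    where open ≡-Reasoning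
  hit-partialSum (suc T) = begin
    sumBelow (suc T) (hit k ℓ) ⊕ hit k ℓ (suc T)  ≡⟨ cong (_⊕ hit k ℓ (suc T)) (hit-partialSum T) ⟩
    (1ℚ ⊖ S T) ⊕ hit k ℓ (suc T)                  ≡⟨ solve 2 (λ s h → (con 1ℚ :- s) :+ h := con 1ℚ :- (s :- h)) refl (S T) (hit k ℓ (suc T)) ⟩
    1ℚ ⊖ (S T ⊖ hit k ℓ (suc T))                  ≡⟨ cong (1ℚ ⊖_) (S-step T) ⟨
    1ℚ ⊖ S (suc T)                                ∎
    where open ≡-Reasoning

  weighted-partialSum : ∀ T → sumBelow (suc T) (λ t → fromℕ t ⊗ hit k ℓ t) ≡ fromℕ (g ℓ) ⊖ M T ⊖ fromℕ T ⊗ S T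
  weighted-partialSum zero = begin
    0ℚ ⊕ 0ℚ ⊗ hit k ℓ 0              ≡⟨ solve 3 (λ h x s → con 0ℚ :+ con 0ℚ :* h := x :- x :- con 0ℚ :* s) refl (hit k ℓ 0) (M 0) (S 0) ⟩
    M 0 ⊖ M 0 ⊖ 0ℚ ⊗ S 0             ≡⟨ cong (λ x → x ⊖ M 0 ⊖ 0ℚ ⊗ S 0) M-initial ⟩
    fromℕ (g ℓ) ⊖ M 0 ⊖ 0ℚ ⊗ S 0     ∎
    where open ≡-Reasoning
  weighted-partialSum (suc T) = begin
    sumBelow (suc T) w ⊕ fromℕ (suc T) ⊗ hit k ℓ (suc T)
      ≡⟨ cong₂ (λ x y → x ⊕ y ⊗ hit k ℓ (suc T)) (weighted-partialSum T) (fromℕ-+ 1 T) ⟩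
    (H ⊖ M T ⊖ fromℕ T ⊗ S T) ⊕ (1ℚ ⊕ fromℕ T) ⊗ hit k ℓ (suc T)
      ≡⟨ solve 5 (λ H x s h t → (H :- x :- t :* s) :+ (con 1ℚ :+ t) :* h := H :- (x :- s) :- (con 1ℚ :+ t) :* (s :- h))
               refl H (M T) (S T) (hit k ℓ (suc T)) (fromℕ T) ⟩
    H ⊖ (M T ⊖ S T) ⊖ (1ℚ ⊕ fromℕ T) ⊗ (S T ⊖ hit k ℓ (suc T))
      ≡⟨ cong₂ (λ x y → H ⊖ x ⊖ y) (M-step T) (cong₂ _⊗_ (fromℕ-+ 1 T) (S-step T)) ⟨
    H ⊖ M (suc T) ⊖ fromℕ (suc T) ⊗ S (suc T)
      ∎
    where
    open ≡-Reasoning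
    w = λ t → fromℕ t ⊗ hit k ℓ t
    H = fromℕ (g ℓ)

  0≤S : ∀ t → 0ℚ ≤ℚ S t
  0≤S t = sum1to-nonNeg k (ν k ℓ t) (λ j _ _ → 0≤ν t j)

  0≤M : ∀ t → 0ℚ ≤ℚ M t
  0≤M t = sum1to-nonNeg k _ (λ j _ _ → 0≤* (0≤ν t j) (0≤fromℕ (g j)))

  S≤M : ∀ t → S t ≤ℚ M t
  S≤M t = sum1to-mono-≤ k _ _ λ j 1≤j j≤k → begin
    ν k ℓ t j                 ≡⟨ ℚ.*-identityʳ (ν k ℓ t j) ⟨
    ν k ℓ t j ⊗ 1ℚ            ≤⟨ *-monoˡ-≤-0≤ (ν k ℓ t j) (0≤ν t j) (fromℕ-mono-≤ (g-positive j 1≤j j≤k)) ⟩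
    ν k ℓ t j ⊗ fromℕ (g j)   ∎
    where open ℚ.≤-Reasoning

  M≤[1+G]*S : ∀ t → M t ≤ℚ fromℕ (suc G) ⊗ S t
  M≤[1+G]*S t = begin
    M t                                        ≤⟨ sum1to-mono-≤ k _ _ (λ j 1≤j j≤k →
                                                    *-monoˡ-≤-0≤ (ν k ℓ t j) (0≤ν t j) (fromℕ-mono-≤ (g-bounded j 1≤j j≤k))) ⟩
    sum1to k (λ j → ν k ℓ t j ⊗ fromℕ (suc G)) ≡⟨ sum1to-*ʳ k (fromℕ (suc G)) (ν k ℓ t) ⟩
    S t ⊗ fromℕ (suc G)                        ≡⟨ ℚ.*-comm (S t) (fromℕ (suc G)) ⟩
    fromℕ (suc G) ⊗ S t                        ∎
    where open ℚ.≤-Reasoning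

  M-decay : ∀ t → fromℕ (suc G) ⊗ M (suc t) ≤ℚ fromℕ G ⊗ M t
  M-decay t = begin
    H ⊗ M (suc t)          ≡⟨ cong (H ⊗_) (M-step t) ⟩
    H ⊗ (M t ⊖ S t)        ≡⟨ solve 3 (λ h x s → h :* (x :- s) := h :* x :- h :* s) refl H (M t) (S t) ⟩
    H ⊗ M t ⊖ H ⊗ S t      ≤⟨ ℚ.+-monoʳ-≤ (H ⊗ M t) (ℚ.neg-antimono-≤ (M≤[1+G]*S t)) ⟩
    H ⊗ M t ⊖ M t          ≡⟨ cong (λ x → x ⊗ M t ⊖ M t) (fromℕ-+ 1 G) ⟩
    (1ℚ ⊕ fromℕ G) ⊗ M t ⊖ M t ≡⟨ solve 2 (λ g x → (con 1ℚ :+ g) :* x :- x := g :* x) refl (fromℕ G) (M t) ⟩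
    fromℕ G ⊗ M t          ∎
    where
    open ℚ.≤-Reasoning
    H = fromℕ (suc G)

  [1+T]*M→0 : TendsToZero (λ T → fromℕ (suc T) ⊗ M T)
  [1+T]*M→0 = geometric⇒linear-weighted-tendsToZero G (g ℓ) M 0≤M (ℚ.≤-reflexive M-initial) M-decay

  M≤[1+T]*M : ∀ T → M T ≤ℚ fromℕ (suc T) ⊗ M T
  M≤[1+T]*M T = begin
    M T                    ≡⟨ ℚ.*-identityˡ (M T) ⟨
    1ℚ ⊗ M T               ≤⟨ *-monoʳ-≤-0≤ (M T) (0≤M T) (fromℕ-mono-≤ {1} {suc T} (s≤s z≤n)) ⟩
    fromℕ (suc T) ⊗ M T    ∎
    where open ℚ.≤-Reasoning

  hit-error : ∀ T → ℚ.∣ sumBelow (suc T) (hit k ℓ) ⊖ 1ℚ ∣ ≤ℚ fromℕ (suc T) ⊗ M T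
  hit-error T = begin
    ℚ.∣ sumBelow (suc T) (hit k ℓ) ⊖ 1ℚ ∣  ≡⟨ cong (λ x → ℚ.∣ x ⊖ 1ℚ ∣) (hit-partialSum T) ⟩
    ℚ.∣ 1ℚ ⊖ S T ⊖ 1ℚ ∣                    ≡⟨ cong ℚ.∣_∣ (solve 1 (λ s → con 1ℚ :- s :- con 1ℚ := :- s) refl (S T)) ⟩
    ℚ.∣ ⊝ S T ∣                            ≡⟨ ℚ.∣-p∣≡∣p∣ (S T) ⟩
    ℚ.∣ S T ∣                              ≡⟨ ℚ.0≤p⇒∣p∣≡p (0≤S T) ⟩
    S T                                    ≤⟨ S≤M T ⟩
    M T                                    ≤⟨ M≤[1+T]*M T ⟩
    fromℕ (suc T) ⊗ M T                    ∎
    where open ℚ.≤-Reasoning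

  weighted-error : ∀ T → ℚ.∣ sumBelow (suc T) (λ t → fromℕ t ⊗ hit k ℓ t) ⊖ fromℕ (g ℓ) ∣ ≤ℚ fromℕ (suc T) ⊗ M T
  weighted-error T = begin
    ℚ.∣ sumBelow (suc T) (λ t → fromℕ t ⊗ hit k ℓ t) ⊖ H ∣  ≡⟨ cong (λ x → ℚ.∣ x ⊖ H ∣) (weighted-partialSum T) ⟩
    ℚ.∣ H ⊖ M T ⊖ fromℕ T ⊗ S T ⊖ H ∣                        ≡⟨ cong ℚ.∣_∣ (solve 4 (λ h x s t → h :- x :- t :* s :- h := :- (x :+ t :* s))
                                                                                   refl H (M T) (S T) (fromℕ T)) ⟩
    ℚ.∣ ⊝ (M T ⊕ fromℕ T ⊗ S T) ∣                            ≡⟨ ℚ.∣-p∣≡∣p∣ (M T ⊕ fromℕ T ⊗ S T) ⟩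
    ℚ.∣ M T ⊕ fromℕ T ⊗ S T ∣                                ≡⟨ ℚ.0≤p⇒∣p∣≡p (0≤+ (0≤M T) (0≤* (0≤fromℕ T) (0≤S T))) ⟩
    M T ⊕ fromℕ T ⊗ S T                                      ≤⟨ ℚ.+-monoʳ-≤ (M T) (*-monoˡ-≤-0≤ (fromℕ T) (0≤fromℕ T) (S≤M T)) ⟩
    M T ⊕ fromℕ T ⊗ M T                                      ≡⟨ solve 2 (λ x t → x :+ t :* x := (con 1ℚ :+ t) :* x) refl (M T) (fromℕ T) ⟩
    (1ℚ ⊕ fromℕ T) ⊗ M T                                     ≡⟨ cong (_⊗ M T) (fromℕ-+ 1 T) ⟨
    fromℕ (suc T) ⊗ M T                                      ∎
    where
    open ℚ.≤-Reasoning
    H = fromℕ (g ℓ)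

  expectedAbsorptionTime : ExpectedAbsorptionTimeIs k ℓ (fromℕ (g ℓ))
  expectedAbsorptionTime =
    seriesConvergesTo-if-error-tendsToZero (hit k ℓ) 1ℚ _ hit-error [1+T]*M→0 ,
    seriesConvergesTo-if-error-tendsToZero _ (fromℕ (g ℓ)) _ weighted-error [1+T]*M→0

theorem3 : (k : ℕ) → 1 ≤ k → (ℓ : ℕ) → ℓ ≤ k →
    ExpectedAbsorptionTimeIs k ℓ (+ (k * sumFromTo (k ∸ ℓ + 1) k α) / 1)
theorem3 (suc m) _ ℓ ℓ≤k =
  subst (ExpectedAbsorptionTimeIs k ℓ) (cong fromℕ (h-closed-form ℓ ℓ≤k))
    (Absorption.expectedAbsorptionTime m ℓ ℓ≤k h (h k ∸ 1) refl h-positive h≤1+[hk∸1] h-harmonic)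
  where
  open HarmonicChain m
  h≤1+[hk∸1] : ∀ j → 1 ≤ j → j ≤ k → h j ≤ suc (h k ∸ 1)
  h≤1+[hk∸1] j _ j≤k = ℕ.≤-trans (h-mono-≤ j≤k) (ℕ.m≤n+m∸n (h k) 1)
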